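{- Let $N=(G,S,\mathrm{init},F,\oplus)$ be a network instance, where $G=(V,E)$ is a directed graph with finite node set $V$ and edge set $E\subseteq V\times V$, $S$ is a set of routes, $\mathrm{init}:V\to S$, $F$ assigns to each edge $e\in E$ a function $f_e:S\to S$, and $\oplus:S\times S\to S$ is associative and commutative. Define the simulation state $\sigma:V\to(\mathbb{N}\to S)$ by $\sigma(v)(0)=\mathrm{init}(v)$ and $\sigma(v)(t+1)=\mathrm{init}(v)\oplus\bigoplus_{u:\,uv\in E} f_{uv}(\sigma(u)(t))$. Let $A:V\to(\mathbb{N}\to 2^S)$ satisfy, for every node $v\in V$ with in-neighbors $u_1,\dots,u_n$: (initial condition) $\mathrm{init}(v)\in A(v)(0)$; and (inductive condition) for all $t\in\mathbb{N}$ and all $s_1\in A(u_1)(t),\dots,s_n\in A(u_n)(t)$, we have $\mathrm{init}(v)\oplus\bigoplus_{i=1}^n f_{u_iv}(s_i)\in A(v)(t+1)$. Then for all $v\in V$ and all $t\in\mathbb{N}$, $\sigma(v)(t)\in A(v)(t)$.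
   Context: The in-neighbors of $v$ are the nodes $u$ with $uv\in E$. $\bigoplus$ denotes iterated application of the associative and commutative operation $\oplus$. -}

module Defs where

open import Data.Nat using (ℕ; zero; suc)
open import Data.Fin using (Fin)
open import Data.Bool using (Bool; true; false)
open import Data.List using (List; []; _∷_; filter; allFin)
open import Data.Bool.Properties using (T?)
open import Data.Product using (_×_)
open import Relation.Binary.PropositionalEquality using (_≡_)

-- A network instance: directed graph on V = Fin n (edges given by a Boolean
-- adjacency relation E u v = true iff uv ∈ E), set of routes S, init,
-- edge functions f u v (only used on edges uv ∈ E), and an associative
-- commutative merge ⊕.
record Network (n : ℕ) (S : Set) : Set where
  field
    E    : Fin n → Fin n → Bool
    init : Fin n → S
    f    : Fin n → Fin n → S → S
    _⊕_  : S → S → S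
    ⊕-assoc : ∀ a b c → ((a ⊕ b) ⊕ c) ≡ (a ⊕ (b ⊕ c))
    ⊕-comm  : ∀ a b → (a ⊕ b) ≡ (b ⊕ a)

module _ {n : ℕ} {S : Set} (N : Network n S) where
  open Network N

  inNbrs : Fin n → List (Fin n)
  inNbrs v = filter (λ u → T? (E u v)) (allFin n)

  combine : Fin n → List (Fin n) → (Fin n → S) → S
  combine v []       s = init v
  combine v (u ∷ us) s = combine v us s ⊕ f u v (s u)

  step : Fin n → (Fin n → S) → S
  step v s = combine v (inNbrs v) s

  σ : ℕ → Fin n → S
  σ zero    v = init v
  σ (suc t) v = step v (σ t)

{-# OPTIONS --safe #-}
module Submission where

open import Defs
open import Data.Nat using (ℕ; suc; zero)
open import Data.Fin using (Fin)
open import Data.Bool using (T)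

theorem1 : {n : ℕ} {S : Set} (N : Network n S)
    (A : Fin n → ℕ → S → Set) →
    (∀ v → A v 0 (Network.init N v)) →
    (∀ v t (s : Fin n → S) →
      (∀ u → T (Network.E N u v) → A u t (s u)) →
      A v (suc t) (step N v s)) →
    ∀ v t → A v t (σ N t v)
theorem1 N A initial step-closed = invariant
  where
  invariant : ∀ v t → A v t (σ N t v)
  invariant v zero    = initial v
  invariant v (suc t) = step-closed v t (σ N t) (λ u _ → invariant u t)
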